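{- Let $A=\langle a_1,\ldots,a_m\rangle$ and $B=\langle b_1,\ldots,b_n\rangle$ be sequences of integers, and let $\bar B=\langle m-b_1,\ldots,m-b_n\rangle$. Then $\langle A,B\rangle$ is a score sequence of a bitournament (with partite sets of sizes $m$ and $n$) if and only if $\langle A,B\rangle$ is an $(m,n)$-feasible pair and the iterated normal trimming $\bar B_A$ is defined and equals the zero sequence $\mathbf{0}$.
   Context: A bitournament is an orientation of a complete bipartite graph. If $X=\{x_1,\ldots,x_m\}$ and $Y=\{y_1,\ldots,y_n\}$ are its partite sets, the score of a vertex is its outdegree; if $a_i$ is the score of $x_i$ and $b_j$ the score of $y_j$, the pair $\langle A,B\rangle$ with $A=\langle a_1,\ldots,a_m\rangle$, $B=\langle b_1,\ldots,b_n\rangle$ (in this order, not necessarily sorted) is called a score sequence of the bitournament. An $(m,n)$-sequence is a sequence of $m$ real numbers each in $[0,n]$. A pair $\langle A,B\rangle$ with $A$ an $(m,n)$-sequence and $B$ an $(n,m)$-sequence is an $(m,n)$-feasible pair if the sum of all entries of $A$ plus the sum of all entries of $B$ equals $mn$. For an integer sequence $S$ and an integer $c\ge 0$ at most the number of positive entries of $S$, a normal $c$-trimming $S_{\langle c\rangle}$ is obtained by subtracting $1$ from $c$ largest positive entries of $S$ (for $c=0$, $S_{\langle 0\rangle}=S$). For $C=\langle c_1,\ldots,c_k\rangle$, $S_C=S_{\langle c_1,\ldots,c_k\rangle}$ denotes applying a normal $c_1$-trimming, then a normal $c_2$-trimming to the result, and so on up to a normal $c_k$-trimming; $S_C$ is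 defined (exists) if each step is possible, i.e. at each step $c_i$ does not exceed the number of positive entries of the current sequence. -}

module Defs where

open import Data.Nat using (ℕ; zero; suc)
open import Data.Integer using (ℤ; +_; _+_; _-_; _≤_; _<_)
open import Data.Bool using (Bool; true; false; not; if_then_else_)
open import Data.Fin using (Fin)
open import Data.Vec using (Vec; []; _∷_; lookup; tabulate; map; foldr; replicate)
open import Data.Fin.Subset using (Subset; ∣_∣)
open import Data.Product using (Σ; _×_)
open import Relation.Binary.PropositionalEquality using (_≡_)

-- An orientation of the complete bipartite graph K_{m,n} with partite sets
-- X = {x_1..x_m}, Y = {y_1..y_n}:  O i j ≡ true  means the arc x_i → y_j,
-- O i j ≡ false means the arc y_j → x_i.
Bitournament : ℕ → ℕ → Set
Bitournament m n = Fin m → Fin n → Bool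

scoreX : ∀ {m n} → Bitournament m n → Fin m → ℕ
scoreX O i = ∣ tabulate (λ j → O i j) ∣

scoreY : ∀ {m n} → Bitournament m n → Fin n → ℕ
scoreY O j = ∣ tabulate (λ i → not (O i j)) ∣

IsScoreSequence : ∀ {m n} → Vec ℤ m → Vec ℤ n → Set
IsScoreSequence {m} {n} A B =
  Σ (Bitournament m n) λ O →
    (∀ i → lookup A i ≡ + scoreX O i) × (∀ j → lookup B j ≡ + scoreY O j)

sumℤ : ∀ {k} → Vec ℤ k → ℤ
sumℤ = foldr _ _+_ (+ 0)

IsSequence : ∀ {k} → ℕ → Vec ℤ k → Set
IsSequence {k} l S = ∀ (i : Fin k) → (+ 0 ≤ lookup S i) × (lookup S i ≤ + l)

Feasible : ∀ {m n} → Vec ℤ m → Vec ℤ n → Set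
Feasible {m} {n} A B =
  IsSequence n A × IsSequence m B × (sumℤ A + sumℤ B ≡ + (m Data.Nat.* n))

NormalTrimming : ∀ {n} → ℕ → Vec ℤ n → Vec ℤ n → Set
NormalTrimming {n} c S S' =
  Σ (Subset n) λ T →
    (∣ T ∣ ≡ c)
    × (∀ i → lookup T i ≡ true → + 0 < lookup S i)
    × (∀ i j → lookup T i ≡ true → lookup T j ≡ false → lookup S j ≤ lookup S i)
    × (∀ i → lookup S' i ≡ (if lookup T i then lookup S i - + 1 else lookup S i))

-- IteratedTrimming C S R : S_C is defined (each c_i is a nonnegative integer and
-- the successive normal trimmings exist) and R is the resulting sequence.
data IteratedTrimming {n : ℕ} : ∀ {k} → Vec ℤ k → Vec ℤ n → Vec ℤ n → Set where
  done : ∀ {S} → IteratedTrimming [] S S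
  step : ∀ {k} {c : ℕ} {C : Vec ℤ k} {S S' R} →
         NormalTrimming c S S' → IteratedTrimming C S' R →
         IteratedTrimming (+ c ∷ C) S R

complement : ∀ {n} → ℕ → Vec ℤ n → Vec ℤ n
complement m B = map (λ b → + m - b) B

zeroSeq : ∀ n → Vec ℤ n
zeroSeq n = replicate n (+ 0)

-- Read a bitournament as a 0/1 matrix whose entry (i, j) is 1 when x_i → y_j.
-- Its row sums are the scores of X and its column sums are m − b_j, the entries
-- of B̄, so ⟨A,B⟩ is a score sequence exactly when some 0/1 matrix has row sums A
-- and column sums B̄. A normal a₁-trimming T of B̄ then supplies a first row, and
-- the trimmed sequence is the column-sum vector of the remaining rows. Conversely,
-- the first row of a realisation is a normal trimming as soon as it selects the
-- largest column sums, and every realisation can be brought into that form by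
-- Ryser interchanges: if the first row contains y_j but not y_k while column k is
-- larger than column j, then some other row contains y_k but not y_j, and
-- reversing the 4-cycle x₁ y_j x_r y_k keeps all row and column sums while
-- strictly decreasing the total column sum outside the first row. Feasibility is
-- double counting of the arcs.
module Submission where

open import Defs
open import Data.Nat using (ℕ; zero; suc; _+_; _*_; _≤_; _<_; _<?_; z≤n; s≤s)
import Data.Nat.Properties as ℕₚ
open import Data.Nat.Induction using (<-wellFounded)
open import Data.Integer using (ℤ; +_; _-_; +≤+; +<+) renaming (_≤_ to _≤ℤ_; _<_ to _<ℤ_)
import Data.Integer as ℤ
open import Data.Integer.Tactic.RingSolver using (solve-∀)
open import Data.Bool using (Bool; true; false; not; _∨_; _∧_; _xor_; if_then_else_)
open import Data.Bool.Properties using (¬-not; ∨-zeroʳ; ∧-identityʳ; ∧-zeroʳ) renaming (_≟_ to _≟ᵇ_)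
open import Data.Fin using (Fin; zero; suc; _≟_; punchIn)
open import Data.Fin.Properties using (punchInᵢ≢i; any?)
open import Data.Fin.Subset using (Subset; ∣_∣)
open import Data.Fin.Subset.Properties using (∣p∣≤n)
open import Data.Vec using (Vec; []; _∷_; lookup; tabulate; replicate)
open import Data.Vec.Properties using (lookup∘tabulate; tabulate∘lookup; lookup-replicate; lookup-map)
import Data.Vec.Functional as F
open import Data.Vec.Functional.Properties using (updateAt-updates; updateAt-minimal)
open import Data.Product using (∃; ∃₂; _×_; _,_; map)
open import Data.Sum using (_⊎_; inj₁; inj₂)
open import Function using (_∘_; id)
open import Function.Bundles using (_⇔_; mk⇔; Equivalence)
open import Induction.WellFounded using (Acc; acc)
open import Relation.Nullary using (does; yes; no)
open import Relation.Nullary.Decidable using (dec-true; dec-false; _×-dec_)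
open import Relation.Binary.PropositionalEquality
  using (_≡_; _≢_; refl; sym; trans; cong; cong₂; subst; subst₂; module ≡-Reasoning)
open import Algebra.Properties.CommutativeMonoid.Sum ℕₚ.+-0-commutativeMonoid
  using (sum; sum-syntax; sum-remove; sum-cong-≗; ∑-distrib-+; ∑-comm)
open import Algebra.Properties.CommutativeSemigroup ℕₚ.+-commutativeSemigroup
  using (xy∙z≈zy∙x; xy∙z≈xz∙y; xy∙z≈x∙zy)

bit : Bool → ℕ
bit true  = 1
bit false = 0

count : ∀ {n} → (Fin n → Bool) → ℕ
count {n} f = ∑[ z < n ] bit (f z)

count-tabulate : ∀ {n} (f : Fin n → Bool) → ∣ tabulate f ∣ ≡ count f
count-tabulate {zero}  f = refl
count-tabulate {suc n} f with f zero
... | true  = cong suc (count-tabulate (f ∘ suc))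
... | false = count-tabulate (f ∘ suc)

count-lookup : ∀ {n} (T : Subset n) → ∣ T ∣ ≡ count (lookup T)
count-lookup T = trans (cong ∣_∣ (sym (tabulate∘lookup T))) (count-tabulate (lookup T))

∑-const : ∀ n k → ∑[ _ < n ] k ≡ n * k
∑-const zero    k = refl
∑-const (suc n) k = cong (_+_ k) (∑-const n k)

count+count-not : ∀ {n} (f : Fin n → Bool) → count f + count (not ∘ f) ≡ n
count+count-not {n} f = begin
  count f + count (not ∘ f)                 ≡⟨ ∑-distrib-+ (bit ∘ f) (bit ∘ not ∘ f) ⟨
  ∑[ z < n ] (bit (f z) + bit (not (f z)))  ≡⟨ sum-cong-≗ (bit+bit-not ∘ f) ⟩
  ∑[ _ < n ] 1                              ≡⟨ ∑-const n 1 ⟩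
  n * 1                                     ≡⟨ ℕₚ.*-identityʳ n ⟩
  n                                         ∎
  where
  open ≡-Reasoning
  bit+bit-not : ∀ b → bit b + bit (not b) ≡ 1
  bit+bit-not true  = refl
  bit+bit-not false = refl

count-witness : ∀ {n} (f g : Fin n → Bool) → count g < count f →
                ∃ λ z → f z ≡ true × g z ≡ false
count-witness {suc n} f g g<f with f zero in fz | g zero in gz
... | true  | false = zero , fz , gz
... | true  | true  = map suc id (count-witness (f ∘ suc) (g ∘ suc) (ℕₚ.≤-pred g<f))
... | false | false = map suc id (count-witness (f ∘ suc) (g ∘ suc) g<f)
... | false | true  = map suc id (count-witness (f ∘ suc) (g ∘ suc) (ℕₚ.<-trans (ℕₚ.n<1+n _) g<f))

sum-update : ∀ {n} (f g : Fin n → ℕ) (x : Fin n) → (∀ z → z ≢ x → f z ≡ g z) →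
             sum f + g x ≡ sum g + f x
sum-update {suc n} f g x f≗g = begin
  sum f + g x                      ≡⟨ cong (_+ g x) (sum-remove {i = x} f) ⟩
  f x + sum (f ∘ punchIn x) + g x  ≡⟨ cong (λ s → f x + s + g x) (sum-cong-≗ (f≗g _ ∘ punchInᵢ≢i x)) ⟩
  f x + sum (g ∘ punchIn x) + g x  ≡⟨ xy∙z≈zy∙x (f x) _ (g x) ⟩
  g x + sum (g ∘ punchIn x) + f x  ≡⟨ cong (_+ f x) (sum-remove {i = x} g) ⟨
  sum g + f x                      ∎
  where open ≡-Reasoning

-- Pass through h, which agrees with f except at x and with g except at y.
sum-update₂ : ∀ {n} (f g : Fin n → ℕ) {x y : Fin n} → x ≢ y →
              (∀ z → z ≢ x → z ≢ y → f z ≡ g z) →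
              sum f + g x + g y ≡ sum g + f x + f y
sum-update₂ f g {x} {y} x≢y f≗g = begin
  sum f + g x + g y  ≡⟨ cong (λ v → sum f + v + g y) (updateAt-updates x f) ⟨
  sum f + h x + g y  ≡⟨ cong (_+ g y) (sum-update f h x f≗h) ⟩
  sum h + f x + g y  ≡⟨ xy∙z≈xz∙y (sum h) (f x) (g y) ⟩
  sum h + g y + f x  ≡⟨ cong (_+ f x) (sum-update h g y h≗g) ⟩
  sum g + h y + f x  ≡⟨ cong (λ v → sum g + v + f x) (updateAt-minimal y x f (x≢y ∘ sym)) ⟩
  sum g + f y + f x  ≡⟨ xy∙z≈xz∙y (sum g) (f y) (f x) ⟩
  sum g + f x + f y  ∎
  where
  open ≡-Reasoning
  h : F.Vector ℕ _
  h = F.updateAt f x (λ _ → g x)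
  f≗h : ∀ z → z ≢ x → f z ≡ h z
  f≗h z z≢x = sym (updateAt-minimal z x f z≢x)
  h≗g : ∀ z → z ≢ y → h z ≡ g z
  h≗g z z≢y with z ≟ x
  ... | yes refl = updateAt-updates x f
  ... | no z≢x   = trans (updateAt-minimal z x f z≢x) (f≗g z z≢x z≢y)

isOneOf : ∀ {n} → Fin n → Fin n → Fin n → Bool
isOneOf x y z = does (z ≟ x) ∨ does (z ≟ y)

isOneOf-first : ∀ {n} (x y : Fin n) → isOneOf x y x ≡ true
isOneOf-first x y rewrite dec-true (x ≟ x) refl = refl

isOneOf-second : ∀ {n} (x y : Fin n) → isOneOf x y y ≡ true
isOneOf-second x y rewrite dec-true (y ≟ y) refl = ∨-zeroʳ (does (y ≟ x))

isOneOf-neither : ∀ {n} {x y z : Fin n} → z ≢ x → z ≢ y → isOneOf x y z ≡ false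
isOneOf-neither {x = x} {y} {z} z≢x z≢y rewrite dec-false (z ≟ x) z≢x | dec-false (z ≟ y) z≢y = refl

isOneOf-elim : ∀ {n} (P : Fin n → Set) {x y z : Fin n} → P x → P y → isOneOf x y z ≡ true → P z
isOneOf-elim P {x} {y} {z} Px Py z∈ with z ≟ x | z ≟ y
... | yes refl | _        = Px
... | no _     | yes refl = Py

flip₂ : ∀ {n} → Fin n → Fin n → (Fin n → Bool) → Fin n → Bool
flip₂ x y f z = isOneOf x y z xor f z

count-flip₂ : ∀ {n} {x y : Fin n} (f : Fin n → Bool) → f x ≢ f y → count (flip₂ x y f) ≡ count f
count-flip₂ {x = x} {y} f fx≢fy = ℕₚ.+-cancelʳ-≡ (bit (f x) + bit (f y)) _ _ (begin
  count f′ + (bit (f x) + bit (f y))  ≡⟨ ℕₚ.+-assoc (count f′) _ _ ⟨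
  count f′ + bit (f x) + bit (f y)    ≡⟨ sum-update₂ (bit ∘ f) (bit ∘ f′) x≢y f≗f′ ⟨
  count f + bit (f′ x) + bit (f′ y)   ≡⟨ cong₂ (λ u v → count f + bit u + bit v) f′x f′y ⟩
  count f + bit (f y) + bit (f x)     ≡⟨ xy∙z≈x∙zy (count f) _ _ ⟩
  count f + (bit (f x) + bit (f y))   ∎)
  where
  open ≡-Reasoning
  f′ = flip₂ x y f
  x≢y : x ≢ y
  x≢y = fx≢fy ∘ cong f
  f≗f′ : ∀ z → z ≢ x → z ≢ y → bit (f z) ≡ bit (f′ z)
  f≗f′ z z≢x z≢y rewrite isOneOf-neither z≢x z≢y = refl
  f′x : f′ x ≡ f y
  f′x rewrite isOneOf-first x y = sym (¬-not (fx≢fy ∘ sym))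
  f′y : f′ y ≡ f x
  f′y rewrite isOneOf-second x y = sym (¬-not fx≢fy)

-- Equals m − scoreY O j, the j-th entry of B̄ (scoreY+indegreeY).
indegreeY : ∀ {m n} → Bitournament m n → Fin n → ℕ
indegreeY O j = count (λ i → O i j)

interchange : ∀ {m n} → Fin m → Fin m → Fin n → Fin n → Bitournament m n → Bitournament m n
interchange i i′ j k O a b = (isOneOf i i′ a ∧ isOneOf j k b) xor O a b

interchange-row : ∀ {m n} (O : Bitournament m n) (i i′ : Fin m) (j k : Fin n) →
                        ∀ b → interchange i i′ j k O i b ≡ flip₂ j k (O i) b
interchange-row O i i′ j k b = cong (λ t → (t ∧ isOneOf j k b) xor O i b) (isOneOf-first i i′)

count-interchange-row : ∀ {m n} {i i′ : Fin m} {j k : Fin n} (O : Bitournament m n) →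
                        O i j ≢ O i k → O i′ j ≢ O i′ k →
                        ∀ a → count (interchange i i′ j k O a) ≡ count (O a)
count-interchange-row {i = i} {i′} {j} {k} O dᵢ dᵢ′ a with isOneOf i i′ a in a∈
... | false = refl
... | true  = count-flip₂ (O a) (isOneOf-elim (λ a → O a j ≢ O a k) dᵢ dᵢ′ a∈)

count-interchange-col : ∀ {m n} {i i′ : Fin m} {j k : Fin n} (O : Bitournament m n) →
                        O i j ≢ O i′ j → O i k ≢ O i′ k →
                        ∀ b → indegreeY (interchange i i′ j k O) b ≡ indegreeY O b
count-interchange-col {i = i} {i′} {j} {k} O dⱼ dₖ b with isOneOf j k b in b∈
... | false = sum-cong-≗ (λ a → cong (λ t → bit (t xor O a b)) (∧-zeroʳ (isOneOf i i′ a)))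
... | true  = trans (sum-cong-≗ (λ a → cong (λ t → bit (t xor O a b)) (∧-identityʳ (isOneOf i i′ a))))
                    (count-flip₂ (λ a → O a b) (isOneOf-elim (λ b → O i b ≢ O i′ b) dⱼ dₖ b∈))

record HasMargins {m n} (O : Bitournament m n) (r : Fin m → ℕ) (c : Fin n → ℕ) : Set where
  constructor margins
  field
    rowCounts : ∀ a → count (O a) ≡ r a
    colCounts : ∀ b → indegreeY O b ≡ c b

interchange-margins : ∀ {m n} {O : Bitournament m n} {r c} {i i′ : Fin m} {j k : Fin n} →
                      O i j ≡ true → O i k ≡ false → O i′ j ≡ false → O i′ k ≡ true →
                      HasMargins O r c → HasMargins (interchange i i′ j k O) r c
interchange-margins {O = O} Oij Oik Oi′j Oi′k (margins rows cols) = margins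
  (λ a → trans (count-interchange-row O (differ Oij Oik) (differ Oi′j Oi′k) a) (rows a))
  (λ b → trans (count-interchange-col O (differ Oij Oi′j) (differ Oik Oi′k) b) (cols b))
  where
  differ : ∀ {u v b} → u ≡ b → v ≡ not b → u ≢ v
  differ {b = true}  refl refl ()
  differ {b = false} refl refl ()

SelectsLargest : ∀ {n} → (Fin n → ℕ) → (Fin n → Bool) → Set
SelectsLargest c R = ∀ j k → R j ≡ true → R k ≡ false → c k ≤ c j

selectsLargest-cong : ∀ {n} {c c′ : Fin n → ℕ} {R : Fin n → Bool} →
                      (∀ j → c j ≡ c′ j) → SelectsLargest c R → SelectsLargest c′ R
selectsLargest-cong c≗c′ largest j k Rj Rk = subst₂ _≤_ (c≗c′ k) (c≗c′ j) (largest j k Rj Rk)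

selectsLargest-or-inversion : ∀ {n} (c : Fin n → ℕ) (R : Fin n → Bool) →
  SelectsLargest c R ⊎ ∃₂ λ j k → R j ≡ true × R k ≡ false × c j < c k
selectsLargest-or-inversion c R
  with any? (λ j → any? (λ k → (R j ≟ᵇ true) ×-dec (R k ≟ᵇ false) ×-dec (c j <? c k)))
... | yes (j , k , inversion) = inj₂ (j , k , inversion)
... | no ¬inversion = inj₁ (λ j k Rj Rk → ℕₚ.≮⇒≥ (λ cj<ck → ¬inversion (j , k , Rj , Rk , cj<ck)))

outsideWeight : ∀ {n} → (Fin n → ℕ) → (Fin n → Bool) → ℕ
outsideWeight {n} c R = ∑[ z < n ] (if R z then 0 else c z)

outsideWeight-flip₂ : ∀ {n} (c : Fin n → ℕ) (R : Fin n → Bool) {j k : Fin n} →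
                      R j ≡ true → R k ≡ false → c j < c k →
                      outsideWeight c (flip₂ j k R) < outsideWeight c R
outsideWeight-flip₂ c R {j} {k} Rj Rk cj<ck = ℕₚ.+-cancelʳ-< (c k) _ _ (begin-strict
  outsideWeight c R′ + c k             ≡⟨ cong (_+ c k) (ℕₚ.+-identityʳ _) ⟨
  outsideWeight c R′ + 0 + c k         ≡⟨ cong₂ (λ u v → outsideWeight c R′ + weight u (c j) + weight v (c k))
                                                Rj Rk ⟨
  outsideWeight c R′ + w R j + w R k   ≡⟨ sum-update₂ (w R′) (w R) j≢k R′≗R ⟩
  outsideWeight c R + w R′ j + w R′ k  ≡⟨ cong₂ (λ u v → outsideWeight c R + weight u (c j) + weight v (c k))
                                                R′j R′k ⟩
  outsideWeight c R + c j + 0          ≡⟨ ℕₚ.+-identityʳ _ ⟩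
  outsideWeight c R + c j              <⟨ ℕₚ.+-monoʳ-< (outsideWeight c R) cj<ck ⟩
  outsideWeight c R + c k              ∎)
  where
  open ℕₚ.≤-Reasoning
  weight : Bool → ℕ → ℕ
  weight b x = if b then 0 else x
  w : (Fin _ → Bool) → Fin _ → ℕ
  w S z = weight (S z) (c z)
  R′ = flip₂ j k R
  j≢k : j ≢ k
  j≢k refl with trans (sym Rj) Rk
  ... | ()
  R′≗R : ∀ z → z ≢ j → z ≢ k → w R′ z ≡ w R z
  R′≗R z z≢j z≢k rewrite isOneOf-neither z≢j z≢k = refl
  R′j : R′ j ≡ false
  R′j rewrite isOneOf-first j k | Rj = refl
  R′k : R′ k ≡ true
  R′k rewrite isOneOf-second j k | Rk = refl

outsideWeight-interchange : ∀ {m n} (c : Fin n → ℕ) (O : Bitournament m n) {i i′ : Fin m} {j k : Fin n} →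
                            O i j ≡ true → O i k ≡ false → c j < c k →
                            outsideWeight c (interchange i i′ j k O i) < outsideWeight c (O i)
outsideWeight-interchange c O {i} {i′} {j} {k} Oij Oik cj<ck =
  subst (_< outsideWeight c (O i))
        (sum-cong-≗ (λ z → cong (λ t → if t then 0 else c z) (sym (interchange-row O i i′ j k z))))
        (outsideWeight-flip₂ c (O i) Oij Oik cj<ck)

normalise : ∀ {m n} {r : Fin m → ℕ} {c : Fin n → ℕ} (i : Fin m) (O : Bitournament m n) →
            HasMargins O r c → ∃ λ O′ → HasMargins O′ r c × SelectsLargest c (O′ i)
normalise {r = r} {c} i O O-margins = go O O-margins (<-wellFounded _)
  where
  go : ∀ O → HasMargins O r c → Acc _<_ (outsideWeight c (O i)) →
       ∃ λ O′ → HasMargins O′ r c × SelectsLargest c (O′ i)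
  go O O-margins@(margins _ colCounts) (acc smaller) with selectsLargest-or-inversion c (O i)
  ... | inj₁ largest = O , O-margins , largest
  ... | inj₂ (j , k , Oij , Oik , cj<ck)
    with count-witness (λ a → O a k) (λ a → O a j) (subst₂ _<_ (sym (colCounts j)) (sym (colCounts k)) cj<ck)
  ... | i′ , Oi′k , Oi′j =
    go (interchange i i′ j k O) (interchange-margins Oij Oik Oi′j Oi′k O-margins)
       (smaller (outsideWeight-interchange c O Oij Oik cj<ck))

record Realises {m n} (O : Bitournament m n) (A : Vec ℤ m) (S : Vec ℤ n) : Set where
  constructor realises
  field
    rows : ∀ i → lookup A i ≡ + count (O i)
    cols : ∀ j → lookup S j ≡ + indegreeY O j

realises-margins : ∀ {m n} {O O′ : Bitournament m n} {A S} →
                   Realises O A S → HasMargins O′ (count ∘ O) (indegreeY O) → Realises O′ A S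
realises-margins (realises rows cols) (margins rows′ cols′) = realises
  (λ i → trans (rows i) (cong +_ (sym (rows′ i))))
  (λ j → trans (cols j) (cong +_ (sym (cols′ j))))

firstRow-normalTrimming : ∀ {m n} {S : Vec ℤ n} (O : Bitournament (suc m) n) →
                          (∀ j → lookup S j ≡ + indegreeY O j) → SelectsLargest (indegreeY O) (O zero) →
                          NormalTrimming (count (O zero)) S (tabulate (λ j → + indegreeY (F.tail O) j))
firstRow-normalTrimming {S = S} O cols largest = T , count-tabulate (O zero) , positive , largestT , trimmed
  where
  T = tabulate (O zero)
  T≗ : ∀ j → lookup T j ≡ O zero j
  T≗ = lookup∘tabulate (O zero)
  positive : ∀ j → lookup T j ≡ true → + 0 <ℤ lookup S j
  positive j Tj rewrite cols j | sym (T≗ j) | Tj = +<+ (s≤s z≤n)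
  largestT : ∀ j k → lookup T j ≡ true → lookup T k ≡ false → lookup S k ≤ℤ lookup S j
  largestT j k Tj Tk rewrite cols j | cols k =
    +≤+ (largest j k (trans (sym (T≗ j)) Tj) (trans (sym (T≗ k)) Tk))
  trimmed : ∀ j → lookup (tabulate (λ j → + indegreeY (F.tail O) j)) j
                  ≡ (if lookup T j then lookup S j - + 1 else lookup S j)
  trimmed j rewrite lookup∘tabulate (λ j → + indegreeY (F.tail O) j) j | cols j | T≗ j with O zero j
  ... | true  = refl
  ... | false = refl

lookup-const⇒replicate : ∀ {n} {A : Set} (V : Vec A n) {x : A} → (∀ j → lookup V j ≡ x) → V ≡ replicate n x
lookup-const⇒replicate []      V≗x = refl
lookup-const⇒replicate (v ∷ V) V≗x = cong₂ _∷_ (V≗x zero) (lookup-const⇒replicate V (V≗x ∘ suc))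

realises⇒trimsToZero : ∀ {m n} {A : Vec ℤ m} {S : Vec ℤ n} (O : Bitournament m n) →
                       Realises O A S → IteratedTrimming A S (zeroSeq n)
realises⇒trimsToZero {A = []} {S} O (realises _ cols) =
  subst (IteratedTrimming [] S) (lookup-const⇒replicate S cols) done
realises⇒trimsToZero {A = a ∷ A} {S} O realisation
  with normalise zero O (margins (λ _ → refl) (λ _ → refl))
... | O′ , O′-margins , largest =
  subst (λ a → IteratedTrimming (a ∷ A) S (zeroSeq _)) (sym (rows zero))
    (step {S' = S′} (firstRow-normalTrimming {S = S} O′ cols largest′)
                    (realises⇒trimsToZero (F.tail O′) (realises (rows ∘ suc) (lookup∘tabulate _))))
  where
  open Realises (realises-margins realisation O′-margins)
  S′ = tabulate (λ j → + indegreeY (F.tail O′) j)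
  largest′ = selectsLargest-cong (sym ∘ HasMargins.colCounts O′-margins) largest

t+[s-t]≡s : ∀ (s t : ℤ) → t ℤ.+ (s - t) ≡ s
t+[s-t]≡s = solve-∀

trimsToZero⇒realises : ∀ {m n} {A : Vec ℤ m} {S : Vec ℤ n} →
                       IteratedTrimming A S (zeroSeq n) → ∃ λ O → Realises O A S
trimsToZero⇒realises done = (λ ()) , realises (λ ()) (λ j → lookup-replicate j (+ 0))
trimsToZero⇒realises (step {c = c} {S = S} (T , |T| , _ , _ , trimmed) rest)
  with trimsToZero⇒realises rest
... | O , realises rows cols = (lookup T F.∷ O) , realises rows′ cols′
  where
  rows′ : ∀ i → lookup (+ c ∷ _) i ≡ + count ((lookup T F.∷ O) i)
  rows′ zero    = cong +_ (trans (sym |T|) (count-lookup T))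
  rows′ (suc i) = rows i
  cols′ : ∀ j → lookup S j ≡ + (bit (lookup T j) + indegreeY O j)
  cols′ j with lookup T j | trans (sym (trimmed j)) (cols j)
  ... | true  | Sj-1≡ = trans (sym (t+[s-t]≡s (lookup S j) (+ 1))) (cong (ℤ._+_ (+ 1)) Sj-1≡)
  ... | false | Sj≡   = Sj≡

complement-iff : ∀ {a b M : ℤ} → a ℤ.+ b ≡ M → ∀ x → (x ≡ a) ⇔ (M - x ≡ b)
complement-iff {a} {b} refl x = mk⇔
  (λ { refl → a+b-a≡b a b })
  (λ M-x≡b → begin
    x                       ≡⟨ x≡y-[y-x] x (a ℤ.+ b) ⟩
    a ℤ.+ b - (a ℤ.+ b - x) ≡⟨ cong (λ t → a ℤ.+ b - t) M-x≡b ⟩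
    a ℤ.+ b - b             ≡⟨ a+b-b≡a a b ⟩
    a                       ∎)
  where
  open ≡-Reasoning
  a+b-a≡b : ∀ a b → a ℤ.+ b - a ≡ b
  a+b-a≡b = solve-∀
  a+b-b≡a : ∀ a b → a ℤ.+ b - b ≡ a
  a+b-b≡a = solve-∀
  x≡y-[y-x] : ∀ x y → x ≡ y - (y - x)
  x≡y-[y-x] = solve-∀

scoreY+indegreeY : ∀ {m n} (O : Bitournament m n) (j : Fin n) → scoreY O j + indegreeY O j ≡ m
scoreY+indegreeY O j = begin
  scoreY O j + indegreeY O j                 ≡⟨ cong (_+ indegreeY O j) (count-tabulate (λ i → not (O i j))) ⟩
  count (λ i → not (O i j)) + indegreeY O j  ≡⟨ ℕₚ.+-comm _ (indegreeY O j) ⟩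
  indegreeY O j + count (λ i → not (O i j))  ≡⟨ count+count-not (λ i → O i j) ⟩
  _                                          ∎
  where open ≡-Reasoning

scores⇔realisesComplement : ∀ {m n} {A : Vec ℤ m} {B : Vec ℤ n} (O : Bitournament m n) →
  ((∀ i → lookup A i ≡ + scoreX O i) × (∀ j → lookup B j ≡ + scoreY O j))
  ⇔ Realises O A (complement m B)
scores⇔realisesComplement {m} {B = B} O = mk⇔
  (λ (rows , cols) → realises (λ i → trans (rows i) (rowCount i))
                              (λ j → trans (lookup-complement j) (Equivalence.to (cols-iff j) (cols j))))
  (λ (realises rows cols) → (λ i → trans (rows i) (sym (rowCount i)))
                          , (λ j → Equivalence.from (cols-iff j) (trans (sym (lookup-complement j)) (cols j))))
  where
  rowCount : ∀ i → + scoreX O i ≡ + count (O i)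
  rowCount i = cong +_ (count-tabulate (O i))
  lookup-complement : ∀ j → lookup (complement m B) j ≡ + m - lookup B j
  lookup-complement j = lookup-map j (λ b → + m - b) B
  cols-iff : ∀ j → (lookup B j ≡ + scoreY O j) ⇔ (+ m - lookup B j ≡ + indegreeY O j)
  cols-iff j = complement-iff (cong +_ (scoreY+indegreeY O j)) (lookup B j)

isSequence-cardinalities : ∀ {k l} (V : Vec ℤ k) (p : Fin k → Subset l) →
                           (∀ i → lookup V i ≡ + ∣ p i ∣) → IsSequence l V
isSequence-cardinalities V p V≗p i rewrite V≗p i = +≤+ z≤n , +≤+ (∣p∣≤n (p i))

sumℤ-pos : ∀ {k} (V : Vec ℤ k) (f : Fin k → ℕ) → (∀ i → lookup V i ≡ + f i) → sumℤ V ≡ + sum f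
sumℤ-pos []      f V≗f = refl
sumℤ-pos (v ∷ V) f V≗f = cong₂ ℤ._+_ (V≗f zero) (sumℤ-pos V (f ∘ suc) (V≗f ∘ suc))

∑scoreX+∑scoreY≡m*n : ∀ {m n} (O : Bitournament m n) →
                      ∑[ i < m ] scoreX O i + ∑[ j < n ] scoreY O j ≡ m * n
∑scoreX+∑scoreY≡m*n {m} {n} O = begin
  ∑[ i < m ] scoreX O i + ∑[ j < n ] scoreY O j
    ≡⟨ cong₂ _+_ (sum-cong-≗ (count-tabulate ∘ O))
                 (sum-cong-≗ (λ j → count-tabulate (λ i → not (O i j)))) ⟩
  ∑[ i < m ] count (O i) + ∑[ j < n ] count (λ i → not (O i j))
    ≡⟨ cong (_+ ∑[ j < n ] count (λ i → not (O i j))) (∑-comm (λ i j → bit (O i j))) ⟩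
  ∑[ j < n ] indegreeY O j + ∑[ j < n ] count (λ i → not (O i j))
    ≡⟨ ∑-distrib-+ (indegreeY O) (λ j → count (λ i → not (O i j))) ⟨
  ∑[ j < n ] (indegreeY O j + count (λ i → not (O i j)))
    ≡⟨ sum-cong-≗ (λ j → count+count-not (λ i → O i j)) ⟩
  ∑[ j < n ] m
    ≡⟨ ∑-const n m ⟩
  n * m
    ≡⟨ ℕₚ.*-comm n m ⟩
  m * n ∎
  where open ≡-Reasoning

scoreSequence⇒feasible : ∀ {m n} {A : Vec ℤ m} {B : Vec ℤ n} → IsScoreSequence A B → Feasible A B
scoreSequence⇒feasible {m} {n} {A} {B} (O , rows , cols) =
    isSequence-cardinalities A (λ i → tabulate (O i)) rows
  , isSequence-cardinalities B (λ j → tabulate (λ i → not (O i j))) cols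
  , (begin
      sumℤ A ℤ.+ sumℤ B
        ≡⟨ cong₂ ℤ._+_ (sumℤ-pos A (scoreX O) rows) (sumℤ-pos B (scoreY O) cols) ⟩
      + (∑[ i < m ] scoreX O i + ∑[ j < n ] scoreY O j)
        ≡⟨ cong +_ (∑scoreX+∑scoreY≡m*n O) ⟩
      + (m * n) ∎)
  where open ≡-Reasoning

mainTheorem1 : (m n : ℕ) (A : Vec ℤ m) (B : Vec ℤ n) →
    IsScoreSequence A B ⇔ (Feasible A B × IteratedTrimming A (complement m B) (zeroSeq n))
mainTheorem1 m n A B = mk⇔
  (λ scores@(O , scoresOfO) →
       scoreSequence⇒feasible {A = A} {B} scores
     , realises⇒trimsToZero O (Equivalence.to (scores⇔realisesComplement O) scoresOfO))
  (λ (_ , trimming) →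
     let O , realisation = trimsToZero⇒realises trimming
     in O , Equivalence.from (scores⇔realisesComplement O) realisation)
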